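{- Let $d\ge1$. For any finite family $\mathcal{F}\subseteq \binom{\mathbb{N}}{d}$ one has $|\mathrm{Inc}(\mathcal{F})|\ge\mathrm{Inc}^{[d]}(|\mathcal{F}|)$.
   Context: $\mathbb{N}=\{1,2,\dots\}$; $d$-subsets are written $\mathbf{u}=(u_1,\dots,u_d)$ with $u_1<\dots<u_d$. $\mathrm{Inc}_1$ is the set of maps $\pi:\mathbb{N}\to\mathbb{N}$ with $\pi(j)<\pi(j+1)$, $\pi(j)\le j+1$ for all $j$, acting by $\pi(\mathbf{u})=(\pi(u_1),\dots,\pi(u_d))$; $\mathrm{Inc}(\mathcal{F})=\{\pi(\mathbf{u})\mid\mathbf{u}\in\mathcal{F},\pi\in\mathrm{Inc}_1\}$. Every positive integer $m$ has a unique $d$-binomial representation $m=\binom{a_d}{d}+\binom{a_{d-1}}{d-1}+\cdots+\binom{a_s}{s}$ with $a_d>a_{d-1}>\cdots>a_s\ge s\ge1$; then $\mathrm{Inc}^{[d]}(m)=\binom{a_d+1}{d}+\binom{a_{d-1}+1}{d-1}+\cdots+\binom{a_s+1}{s}$, and $\mathrm{Inc}^{[d]}(0)=0$. -}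

module Defs where

open import Data.Nat using (ℕ; zero; suc; _+_; _≤_; _<_)
open import Data.Nat.Combinatorics using (_C_)
open import Data.Fin as Fin using (Fin)
open import Data.Vec using (Vec; lookup; map)
open import Data.List using (List; []; _∷_)
open import Data.List.Membership.Propositional using (_∈_)
open import Data.Product using (Σ; _×_; ∃)
open import Relation.Binary.PropositionalEquality using (_≡_)

-- A d-subset u = (u₁ < … < u_d) of ℕ = {1,2,…}, as a vector of length d.
IsDSubset : {d : ℕ} → Vec ℕ d → Set
IsDSubset {d} u =
  ((i : Fin d) → 1 ≤ lookup u i) ×
  ((i j : Fin d) → i Fin.< j → lookup u i < lookup u j)

-- Inc₁: maps π : ℕ → ℕ (ℕ = {1,2,…}; the value at 0 is irrelevant) with
-- π(j) ∈ ℕ, π(j) < π(j+1) and π(j) ≤ j+1 for all j ≥ 1.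
IsInc₁ : (ℕ → ℕ) → Set
IsInc₁ π = (j : ℕ) → 1 ≤ j → (1 ≤ π j) × (π j < π (suc j)) × (π j ≤ suc j)

act : {d : ℕ} → (ℕ → ℕ) → Vec ℕ d → Vec ℕ d
act π u = map π u

InInc : {d : ℕ} → List (Vec ℕ d) → Vec ℕ d → Set
InInc F v = Σ _ λ u → (u ∈ F) × ∃ λ π → IsInc₁ π × (v ≡ act π u)

-- d-binomial representation of m:  as = [a_d, a_{d-1}, …, a_s]  with
-- a_d > a_{d-1} > … > a_s ≥ s ≥ 1.  BinRep k as: as is a valid list of
-- coefficients starting at index k.
data BinRep : ℕ → List ℕ → Set where
  single : ∀ {k a} → 1 ≤ k → k ≤ a → BinRep k (a ∷ [])
  cons   : ∀ {k a b as} → b < a → BinRep k (b ∷ as) → BinRep (suc k) (a ∷ b ∷ as)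

binSum : ℕ → List ℕ → ℕ
binSum k [] = 0
binSum zero (a ∷ as) = a C zero
binSum (suc k) (a ∷ as) = (a C suc k) + binSum k as

incSum : ℕ → List ℕ → ℕ
incSum k [] = 0
incSum zero (a ∷ as) = suc a C zero
incSum (suc k) (a ∷ as) = (suc a C suc k) + incSum k as

-- Inc^[d](m) = n, where n is computed from the d-binomial representation
-- of m (and Inc^[d](0) = 0).
data IncD (d : ℕ) : ℕ → ℕ → Set where
  incD-zero : IncD d 0 0
  incD-rep  : ∀ as → BinRep d as → IncD d (binSum d as) (incSum d as)

-- Write ∂ j m for the Kruskal–Katona shadow number: if m = Σ C(a_i,i) is the
-- j-binomial representation, ∂ j m = Σ C(a_i,i-1).  By Pascal's rule
-- Inc^[d](m) = m + ∂ d m =: incBound d m, so it suffices to bound |Inc(F)|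
-- below by incBound d |F|.
--
-- On the combinatorial
-- side, Inc(F) contains all "shifts" of members of F (add 1 to a suffix of
-- the coordinates); splitting F by its least first coordinate and using
-- incBound-split, induction on d and |F| shows that any duplicate-free list
-- containing these shifts has at least incBound d |F| elements
-- (shifts-bound).  The theorem follows since shifts are realised by maps in
-- Inc₁ and Inc^[d] agrees with incBound on binomial representations.
module Submission where

open import Defs
open import Data.Nat using (ℕ; _≤_)
open import Data.Vec using (Vec)
open import Data.List using (List; length)
open import Data.List.Relation.Unary.All using (All)
open import Data.List.Relation.Unary.Unique.Propositional using (Unique)
open import Data.List.Membership.Propositional using (_∈_)

open import Data.Nat
open import Data.Nat.Properties
open import Data.Nat.Combinatorics using (_C_; nCk+nC[k+1]≡[n+1]C[k+1]; k>n⇒nCk≡0)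
open import Data.Nat.Tactic.RingSolver using (solve-∀)
open import Data.Sum using (_⊎_; inj₁; inj₂)
open import Data.Product using (Σ; _×_; _,_; proj₁; proj₂)
open import Data.Empty using (⊥-elim)
open import Data.Unit using (⊤; tt)
open import Data.Fin as Fin using (Fin)
open import Data.Vec using (Vec; []; _∷_; head; tail; lookup) renaming (map to vmap)
open import Data.List using (List; []; _∷_; length; map; filter)
open import Data.List.Properties using (length-map)
open import Data.List.Extrema.Nat using (argmin; argmin-sel; f[argmin]≤f[⊤]; f[argmin]≤f[xs])
open import Data.List.Relation.Unary.AllPairs using ([]; _∷_)
open import Data.List.Relation.Unary.All as All using (All; []; _∷_)
open import Data.List.Relation.Unary.Any using (here; there)
open import Data.List.Membership.Propositional.Properties using (∈-map⁺; ∈-map⁻; ∈-filter⁺; ∈-filter⁻)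
import Data.List.Relation.Unary.Unique.Propositional.Properties as Unique
open import Function using (_∘_)
open import Relation.Binary.PropositionalEquality
open import Relation.Nullary using (yes; no; ¬_; Dec; ¬?; contradiction)
open import Relation.Unary using (Decidable)

mono-from-suc : (f : ℕ → ℕ) → (∀ n → f n ≤ f (suc n)) → ∀ {m n} → m ≤ n → f m ≤ f n
mono-from-suc f step {zero} {zero} z≤n = ≤-refl
mono-from-suc f step {zero} {suc n} z≤n = ≤-trans (mono-from-suc f step z≤n) (step n)
mono-from-suc f step (s≤s m≤n) = mono-from-suc (f ∘ suc) (step ∘ suc) m≤n

-- Binomial coefficients by Pascal's rule, so that the recursion
-- binom (n+1) (k+1) = binom n k + binom n (k+1) holds definitionally
-- (C≡binom below identifies it with the library's _C_).
binom : ℕ → ℕ → ℕ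
binom n zero = 1
binom zero (suc k) = 0
binom (suc n) (suc k) = binom n k + binom n (suc k)

binom-≤-suc : ∀ n k → binom n k ≤ binom (suc n) k
binom-≤-suc n zero = ≤-refl
binom-≤-suc n (suc k) = m≤n+m (binom n (suc k)) (binom n k)

binom-monoˡ : ∀ {a b} k → a ≤ b → binom a k ≤ binom b k
binom-monoˡ k = mono-from-suc (λ a → binom a k) (λ a → binom-≤-suc a k)

binom-pos : ∀ {n k} → k ≤ n → 1 ≤ binom n k
binom-pos {n} {zero} _ = ≤-refl
binom-pos {suc n} {suc k} (s≤s k≤n) = ≤-trans (binom-pos k≤n) (m≤m+n (binom n k) (binom n (suc k)))

binom-vanish : ∀ {n k} → n < k → binom n k ≡ 0
binom-vanish {zero} {suc k} _ = refl
binom-vanish {suc n} {suc k} (s≤s n<k) = cong₂ _+_ (binom-vanish n<k) (binom-vanish (m<n⇒m<1+n n<k))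

binom-pos⇒≤ : ∀ {n k} → 1 ≤ binom n k → k ≤ n
binom-pos⇒≤ {n} {k} h with k ≤? n
... | yes k≤n = k≤n
... | no k≰n = contradiction (subst (1 ≤_) (binom-vanish (≰⇒> k≰n)) h) λ ()

binom-n-1 : ∀ n → binom n 1 ≡ n
binom-n-1 zero = refl
binom-n-1 (suc n) = cong suc (binom-n-1 n)

-- Every n is dominated by some binom (n + m + 1) (m + 1); used to pick a
-- large enough universe for the shadow computation.
n≤binom : ∀ n m → n ≤ binom (n + suc m) (suc m)
n≤binom n zero rewrite binom-n-1 (n + 1) = m≤m+n n 1
n≤binom n (suc m) rewrite +-suc n (suc m) =
  ≤-trans (n≤binom n m) (m≤m+n (binom (n + suc m) (suc m)) (binom (n + suc m) (suc (suc m))))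

binom-zero-or-pos : ∀ a k → binom a k ≡ 0 ⊎ 1 ≤ binom a k
binom-zero-or-pos a k with binom a k
... | zero = inj₁ refl
... | suc _ = inj₂ (s≤s z≤n)

binom-absorb : ∀ n k → suc k * binom n (suc k) + k * binom n k ≡ n * binom n k
binom-absorb zero zero = refl
binom-absorb zero (suc k) = cong₂ _+_ (*-zeroʳ (suc (suc k))) (*-zeroʳ (suc k))
binom-absorb (suc n) zero rewrite binom-n-1 n = simplify n
  where
  simplify : ∀ n → (suc n + 0) + 0 ≡ suc n * 1
  simplify = solve-∀
binom-absorb (suc n) (suc m) =
  trans (expand (binom n m) (binom n (suc m)) (binom n (suc (suc m))) m)
    (trans (cong₂ (λ u v → u + (binom n (suc m) + v + binom n m)) (binom-absorb n (suc m)) (binom-absorb n m))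
      (collect (binom n m) (binom n (suc m)) n))
  where
  expand : ∀ a b c m → suc (suc m) * (b + c) + suc m * (a + b) ≡ (suc (suc m) * c + suc m * b) + (b + (suc m * b + m * a) + a)
  expand = solve-∀
  collect : ∀ a b n → n * b + (b + n * a + a) ≡ suc n * (a + b)
  collect = solve-∀

-- Unimodality of the rows of Pascal's triangle: a value below two binomials
-- C(c,i) and C(c,i+2) is also below the middle one C(c,i+1).  Otherwise
-- C(c,i+1) < C(c,i) and C(c,i+1) < C(c,i+2), and absorption at k = i and
-- k = i+1 forces both c < 2i+1 and 2i+3 < c.
binom-unimodal : ∀ c i s → s ≤ binom c i → s ≤ binom c (suc (suc i)) → s ≤ binom c (suc i)
binom-unimodal c i s s≤x s≤z with s ≤? binom c (suc i)
... | yes s≤y = s≤y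
... | no s≰y = ⊥-elim (<-asym c<2i+1 (≤-trans (m≤n+m _ 2) 2i+3<c))
  where
  x y z : ℕ
  x = binom c i
  y = binom c (suc i)
  z = binom c (suc (suc i))
  y<x : y < x
  y<x = <-≤-trans (≰⇒> s≰y) s≤x
  y<z : y < z
  y<z = <-≤-trans (≰⇒> s≰y) s≤z
  -- absorption at k = i:  c·x = (i+1)·y + i·x < (2i+1)·x
  c<2i+1 : c < suc (i + i)
  c<2i+1 = *-cancelʳ-< x c (suc (i + i)) (begin-strict
      c * x             ≡⟨ sym (binom-absorb c i) ⟩
      suc i * y + i * x <⟨ +-monoˡ-< (i * x) (*-monoʳ-< (suc i) y<x) ⟩
      suc i * x + i * x ≡⟨ regroup i x ⟩
      suc (i + i) * x   ∎)
    where
    open ≤-Reasoning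
    regroup : ∀ i x → suc i * x + i * x ≡ suc (i + i) * x
    regroup = solve-∀
  -- absorption at k = i+1:  (2i+3)·y < (i+2)·z + (i+1)·y = c·y
  2i+3<c : suc (suc (suc (i + i))) < c
  2i+3<c = *-cancelʳ-< y (suc (suc (suc (i + i)))) c (begin-strict
      suc (suc (suc (i + i))) * y ≡⟨ regroup i y ⟩
      suc (suc i) * y + suc i * y <⟨ +-monoˡ-< (suc i * y) (*-monoʳ-< (suc (suc i)) y<z) ⟩
      suc (suc i) * z + suc i * y ≡⟨ binom-absorb c (suc i) ⟩
      c * y                       ∎)
    where
    open ≤-Reasoning
    regroup : ∀ i y → suc (suc (suc (i + i))) * y ≡ suc (suc i) * y + suc i * y
    regroup = solve-∀

C≡binom : ∀ n k → n C k ≡ binom n k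
C≡binom n zero = refl
C≡binom zero (suc k) = k>n⇒nCk≡0 {n = zero} {k = suc k} (s≤s z≤n)
C≡binom (suc n) (suc k) = trans (sym (nCk+nC[k+1]≡[n+1]C[k+1] n k)) (cong₂ _+_ (C≡binom n k) (C≡binom n (suc k)))

-- The Kruskal–Katona shadow number, computed greedily.  For n ≤ C(a,j),
-- shadowIn j a n writes n = C(a_j,j) + C(a_{j-1},j-1) + … with a > a_j > …
-- (the j-binomial representation) and returns C(a_j,j-1) + C(a_{j-1},j-2) + …
shadowIn : ℕ → ℕ → ℕ → ℕ
shadowIn zero a n = 0
shadowIn (suc j) zero n = 0
shadowIn (suc j) (suc a) n with n ≤? binom a (suc j)
... | yes _ = shadowIn (suc j) a n
... | no _ = binom a j + shadowIn j a (n ∸ binom a (suc j))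

shadowIn-small : ∀ j a n → n ≤ binom a (suc j) → shadowIn (suc j) (suc a) n ≡ shadowIn (suc j) a n
shadowIn-small j a n h with n ≤? binom a (suc j)
... | yes _ = refl
... | no ¬h = ⊥-elim (¬h h)

shadowIn-large : ∀ j a n → binom a (suc j) < n → shadowIn (suc j) (suc a) n ≡ binom a j + shadowIn j a (n ∸ binom a (suc j))
shadowIn-large j a n h with n ≤? binom a (suc j)
... | yes p = ⊥-elim (<⇒≱ h p)
... | no _ = refl

shadowIn-suc : ∀ j a n → n ≤ binom a j → shadowIn j (suc a) n ≡ shadowIn j a n
shadowIn-suc zero a n _ = refl
shadowIn-suc (suc j) a n h = shadowIn-small j a n h

shadowIn-widen : ∀ j a n b → n ≤ binom a j → shadowIn j (b + a) n ≡ shadowIn j a n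
shadowIn-widen j a n zero h = refl
shadowIn-widen j a n (suc b) h =
  trans (shadowIn-suc j (b + a) n (≤-trans h (binom-monoˡ j (m≤n+m a b)))) (shadowIn-widen j a n b h)

-- The shadow number ∂ j n, computed in a universe that is always large enough
-- (n ≤ C(n+j,j)).
∂ : ℕ → ℕ → ℕ
∂ j n = shadowIn j (n + j) n

shadowIn-stable : ∀ j a n → n ≤ binom a j → shadowIn j a n ≡ ∂ j n
shadowIn-stable zero a n h = refl
shadowIn-stable (suc m) a n h =
  trans (sym (shadowIn-widen (suc m) a n (n + suc m) h))
    (trans (cong (λ t → shadowIn (suc m) t n) (+-comm (n + suc m) a))
      (shadowIn-widen (suc m) (n + suc m) n a (n≤binom n m)))

shadowIn-zero : ∀ j a → shadowIn j a 0 ≡ 0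
shadowIn-zero zero a = refl
shadowIn-zero (suc j) zero = refl
shadowIn-zero (suc j) (suc a) = trans (shadowIn-small j a 0 z≤n) (shadowIn-zero (suc j) a)

∂-zero : ∀ j → ∂ j 0 ≡ 0
∂-zero j = shadowIn-zero j j

-- The block formula: for 1 ≤ r ≤ C(a,j) the representation of C(a,j+1) + r
-- starts with C(a,j+1), so ∂ (j+1) (C(a,j+1) + r) = C(a,j) + ∂ j r.
∂-block : ∀ j a r → 1 ≤ r → r ≤ binom a j → ∂ (suc j) (binom a (suc j) + r) ≡ binom a j + ∂ j r
∂-block j a r r≥1 r≤ =
  trans (sym (shadowIn-stable (suc j) (suc a) n n≤))
    (trans (shadowIn-large j a n lt)
      (cong (binom a j +_) (trans (cong (shadowIn j a) (m+n∸m≡n (binom a (suc j)) r)) (shadowIn-stable j a r r≤))))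
  where
  n : ℕ
  n = binom a (suc j) + r
  n≤ : n ≤ binom (suc a) (suc j)
  n≤ = ≤-trans (+-monoʳ-≤ (binom a (suc j)) r≤) (≤-reflexive (+-comm (binom a (suc j)) (binom a j)))
  lt : binom a (suc j) < n
  lt = ≤-trans (≤-reflexive (sym (+-comm (binom a (suc j)) 1))) (+-monoʳ-≤ (binom a (suc j)) r≥1)

∂-full : ∀ j a → 1 ≤ binom a (suc j) → ∂ (suc j) (binom a (suc j)) ≡ binom a j
∂-full j zero ()
∂-full j (suc a) h =
  trans (cong (∂ (suc j)) (+-comm (binom a j) (binom a (suc j))))
    (trans (∂-block j a (binom a j) (binom-pos j≤a) ≤-refl) (pascal-∂ j a j≤a))
  where
  j≤a : j ≤ a
  j≤a = ≤-pred (binom-pos⇒≤ {suc a} {suc j} h)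
  -- C(a,j) + ∂ j C(a,j) = C(a,j) + C(a,j-1) = C(a+1,j)
  pascal-∂ : ∀ j a → j ≤ a → binom a j + ∂ j (binom a j) ≡ binom (suc a) j
  pascal-∂ zero a _ = refl
  pascal-∂ (suc j) a j<a = trans (cong (binom a (suc j) +_) (∂-full j a (binom-pos j<a))) (+-comm (binom a (suc j)) (binom a j))

-- The same as an inequality, valid also when C(a,j+1) = 0.
∂-full-≤ : ∀ j a → ∂ (suc j) (binom a (suc j)) ≤ binom a j
∂-full-≤ j a with binom-zero-or-pos a (suc j)
... | inj₂ h = ≤-reflexive (∂-full j a h)
... | inj₁ eq rewrite eq | ∂-zero (suc j) = z≤n

∂-mono-suc : ∀ j n → ∂ j n ≤ ∂ j (suc n)
∂-mono-suc zero n = z≤n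
∂-mono-suc (suc i) n = subst₂ _≤_ (shadowIn-stable (suc i) (suc n + suc i) n n≤) (shadowIn-stable (suc i) (suc n + suc i) (suc n) (n≤binom (suc n) i)) (shadowIn-mono-suc (suc n + suc i) n (n≤binom (suc n) i))
  where
  n≤ : n ≤ binom (suc n + suc i) (suc i)
  n≤ = ≤-trans (n≤1+n n) (n≤binom (suc n) i)
  shadowIn-mono-suc : ∀ a n → suc n ≤ binom a (suc i) → shadowIn (suc i) a n ≤ shadowIn (suc i) a (suc n)
  shadowIn-mono-suc zero n ()
  shadowIn-mono-suc (suc a) n h = by-cases (suc n ≤? binom a (suc i)) (n ≤? binom a (suc i))
   where
   by-cases : Dec (suc n ≤ binom a (suc i)) → Dec (n ≤ binom a (suc i)) → shadowIn (suc i) (suc a) n ≤ shadowIn (suc i) (suc a) (suc n)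
   -- n+1 ≤ C(a,i+1): both lie in the lower part; induction on the universe
   by-cases (yes p) _ = subst₂ _≤_ (sym (shadowIn-small i a n (≤-trans (n≤1+n n) p))) (sym (shadowIn-small i a (suc n) p)) (shadowIn-mono-suc a n p)
   -- n = C(a,i+1): ∂ n = C(a,i) is below the shadow of n+1
   by-cases (no ¬p) (yes q) =
    let eqn : n ≡ binom a (suc i)
        eqn = ≤-antisym q (≤-pred (≰⇒> ¬p))
    in subst₂ _≤_ (sym (shadowIn-small i a n q)) (sym (shadowIn-large i a (suc n) (≰⇒> ¬p)))
         (≤-trans (≤-reflexive (shadowIn-stable (suc i) a n q))
           (≤-trans (≤-reflexive (cong (∂ (suc i)) eqn))
             (≤-trans (∂-full-≤ i a) (m≤m+n (binom a i) _))))
   -- C(a,i+1) < n: the block formula reduces to monotonicity one level down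
   by-cases (no ¬p) (no ¬q) =
     subst₂ _≤_ (sym (shadowIn-large i a n b<n)) (sym (shadowIn-large i a (suc n) (m<n⇒m<1+n b<n)))
       (+-monoʳ-≤ (binom a i)
         (subst₂ _≤_ (sym (shadowIn-stable i a (n ∸ b) rest≤)) (sym (shadowIn-stable i a (suc n ∸ b) rest+1≤))
           (≤-trans (∂-mono-suc i (n ∸ b)) (≤-reflexive (cong (∂ i) (sym (+-∸-assoc 1 (<⇒≤ b<n))))))))
     where
     b : ℕ
     b = binom a (suc i)
     b<n : b < n
     b<n = ≰⇒> ¬q
     rest+1≤ : suc n ∸ b ≤ binom a i
     rest+1≤ = ≤-trans (∸-monoˡ-≤ b h) (≤-reflexive (trans (cong (_∸ b) (+-comm (binom a i) b)) (m+n∸m≡n b (binom a i))))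
     rest≤ : n ∸ b ≤ binom a i
     rest≤ = ≤-trans (∸-monoˡ-≤ b (n≤1+n n)) rest+1≤

∂-mono : ∀ j {m n} → m ≤ n → ∂ j m ≤ ∂ j n
∂-mono j = mono-from-suc (∂ j) (∂-mono-suc j)

∂-block-suc : ∀ j a r → suc r ≤ binom a j → ∂ (suc j) (binom a (suc j) + suc r) ≡ binom a j + ∂ j (suc r)
∂-block-suc j a r h = ∂-block j a (suc r) (s≤s z≤n) h

∂-block-≤ : ∀ j a r → r ≤ binom a j → ∂ (suc j) (binom a (suc j) + r) ≤ binom a j + ∂ j r
∂-block-≤ j a zero h rewrite +-identityʳ (binom a (suc j)) = ≤-trans (∂-full-≤ j a) (m≤m+n (binom a j) (∂ j 0))
∂-block-≤ j a (suc r) h = ≤-reflexive (∂-block-suc j a r h)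

-- The block formula for a full lower block, as an inequality that also
-- covers C(a,j) = 0.
∂-block-full-≥ : ∀ j a → binom a j + ∂ j (binom a j) ≤ ∂ (suc j) (binom a (suc j) + binom a j)
∂-block-full-≥ j a with binom-zero-or-pos a j
... | inj₂ h = ≤-reflexive (sym (∂-block j a (binom a j) h ≤-refl))
... | inj₁ eq rewrite eq | ∂-zero j = z≤n

∂₁-suc : ∀ n → ∂ 1 (suc n) ≡ 1
∂₁-suc n = trans (cong (∂ 1) (trans (+-comm 1 n) (cong (_+ 1) (sym (binom-n-1 n))))) (∂-block 0 n 1 ≤-refl ≤-refl)

∂₁≤1 : ∀ n → ∂ 1 n ≤ 1
∂₁≤1 zero rewrite ∂-zero 1 = z≤n
∂₁≤1 (suc n) rewrite ∂₁-suc n = ≤-refl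

-- The Inc bound: Inc^[d](m) = m + ∂ d m, because Pascal's rule splits each
-- C(a_i+1,i) into C(a_i,i) + C(a_i,i-1).
incBound : ℕ → ℕ → ℕ
incBound d m = m + ∂ d m

binSum-suc : ∀ k a as → binSum (suc k) (a ∷ as) ≡ binom a (suc k) + binSum k as
binSum-suc k a as = cong (_+ binSum k as) (C≡binom a (suc k))

incSum-suc : ∀ k a as → incSum (suc k) (a ∷ as) ≡ binom (suc a) (suc k) + incSum k as
incSum-suc k a as = cong (_+ incSum k as) (C≡binom (suc a) (suc k))

binSum-bounds : ∀ {k b as} → BinRep k (b ∷ as) → (binSum k (b ∷ as) < binom (suc b) k) × (1 ≤ binSum k (b ∷ as))
binSum-bounds {suc k} {b} (single h k≤b) rewrite binSum-suc k b [] | +-identityʳ (binom b (suc k)) =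
  ≤-trans (≤-reflexive (+-comm 1 (binom b (suc k)))) (≤-trans (+-monoʳ-≤ (binom b (suc k)) (binom-pos {b} {k} (≤-trans (n≤1+n k) k≤b))) (≤-reflexive (+-comm (binom b (suc k)) (binom b k))))
  , binom-pos k≤b
binSum-bounds {suc k} {b} {c ∷ as} (cons c<b r) rewrite binSum-suc k b (c ∷ as) with binSum-bounds r
... | lt , pos =
  ≤-trans (≤-reflexive (sym (+-suc (binom b (suc k)) _))) (≤-trans (+-monoʳ-≤ (binom b (suc k)) lt) (≤-trans (+-monoʳ-≤ (binom b (suc k)) (binom-monoˡ k c<b)) (≤-reflexive (+-comm (binom b (suc k)) (binom b k)))))
  , ≤-trans pos (m≤n+m _ (binom b (suc k)))

incSum≤incBound : ∀ {k as} → BinRep k as → incSum k as ≤ incBound k (binSum k as)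
incSum≤incBound {suc k} {a ∷ []} (single h k≤a) rewrite binSum-suc k a [] | incSum-suc k a [] | +-identityʳ (binom a (suc k)) | +-identityʳ (binom (suc a) (suc k)) =
  ≤-reflexive (trans (+-comm (binom a k) (binom a (suc k))) (cong (binom a (suc k) +_) (sym (∂-full k a (binom-pos k≤a)))))
incSum≤incBound {suc k} {a ∷ b ∷ as} (cons b<a r) with binSum-bounds r
... | lt , pos rewrite binSum-suc k a (b ∷ as) | incSum-suc k a (b ∷ as) = begin
    (binom a k + binom a (suc k)) + incSum k (b ∷ as) ≤⟨ +-monoʳ-≤ _ (incSum≤incBound r) ⟩
    (binom a k + binom a (suc k)) + (S + ∂ k S) ≡⟨ regroup (binom a k) (binom a (suc k)) S (∂ k S) ⟩
    (binom a (suc k) + S) + (binom a k + ∂ k S) ≡⟨ cong ((binom a (suc k) + S) +_) (sym (∂-block k a S pos (≤-trans (<⇒≤ lt) (binom-monoˡ k b<a)))) ⟩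
    (binom a (suc k) + S) + ∂ (suc k) (binom a (suc k) + S) ∎
  where
  open ≤-Reasoning
  S : ℕ
  S = binSum k (b ∷ as)
  regroup : ∀ x y s t → (x + y) + (s + t) ≡ (y + s) + (x + t)
  regroup = solve-∀

≤-or-above : ∀ x Y → x ≤ Y ⊎ Σ ℕ (λ r → x ≡ Y + suc r)
≤-or-above x Y with x ≤? Y
... | yes p = inj₁ p
... | no ¬p with m≤n⇒∃[o]m+o≡n (≰⇒> ¬p)
... | k , eq = inj₂ (k , trans (sym eq) (sym (+-suc Y k)))

m+n≡0⇒m≡0×n≡0 : ∀ {m n} → m + n ≡ 0 → m ≡ 0 × n ≡ 0
m+n≡0⇒m≡0×n≡0 {m} eq = m+n≡0⇒m≡0 m eq , m+n≡0⇒n≡0 m eq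

+-≤-chain : ∀ {A X P Y Cx Q} → A + X ≤ P + Y → Cx + Y ≤ X + Q → A + Cx ≤ P + Q
+-≤-chain {A} {X} {P} {Y} {Cx} {Q} i ii = +-cancelʳ-≤ (X + Y) (A + Cx) (P + Q) (begin
    (A + Cx) + (X + Y) ≡⟨ regroupˡ A Cx X Y ⟩
    (A + X) + (Cx + Y) ≤⟨ +-mono-≤ i ii ⟩
    (P + Y) + (X + Q) ≡⟨ regroupʳ P Y X Q ⟩
    (P + Q) + (X + Y) ∎)
  where
  open ≤-Reasoning
  regroupˡ : ∀ A Cx X Y → (A + Cx) + (X + Y) ≡ (A + X) + (Cx + Y)
  regroupˡ = solve-∀
  regroupʳ : ∀ P Y X Q → (P + Y) + (X + Q) ≡ (P + Q) + (X + Y)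
  regroupʳ = solve-∀

-- The four inequalities on shadow numbers proved simultaneously by induction
-- on the level: subadditivity of ∂ j, an exchange inequality for two parts
-- of a full block C(c,j), monotonicity of ∂ in the level, and the peeling
-- inequality  ∂ (i+1) (α+β) ≤ ∂ i α + max (∂ (i+1) β) α.
Subadditive : ℕ → Set
Subadditive j = ∀ x y → ∂ j (x + y) ≤ ∂ j x + ∂ j y

Exchange : ℕ → Set
Exchange j = ∀ c x y g → x ≤ binom c j → y ≤ binom c j → x + y ≡ binom c j + g → ∂ j (binom c j) + ∂ j g ≤ ∂ j x + ∂ j y

LevelMono : ℕ → Set
LevelMono i = ∀ x → ∂ i x ≤ ∂ (suc i) x

Peel : ℕ → Set
Peel i = ∀ α β → ∂ (suc i) (α + β) ≤ ∂ i α + (∂ (suc i) β ⊔ α)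

record LevelFacts (i : ℕ) : Set where
  field
    subadd : Subadditive (suc i)
    exchange : Exchange (suc i)
    levelMono : LevelMono i
    peel : Peel i

-- Level 0: all shadows at level 1 are 0 or 1.
levelFacts-base : LevelFacts 0
levelFacts-base = record { subadd = subadd₁ ; exchange = exchange₁ ; levelMono = λ x → z≤n ; peel = peel₀ }
  where
  subadd₁ : Subadditive 1
  subadd₁ zero y rewrite ∂-zero 1 = ≤-refl
  subadd₁ (suc x) y rewrite ∂₁-suc (x + y) | ∂₁-suc x = s≤s z≤n
  exchange₁ : Exchange 1
  exchange₁ c zero zero g hx hy eq with m+n≡0⇒m≡0×n≡0 {binom c 1} {g} (sym eq)
  ... | e1 , e2 rewrite e1 | e2 | ∂-zero 1 = ≤-refl
  exchange₁ c (suc x) y zero hx hy eq rewrite ∂₁-suc x | ∂-zero 1 = ≤-trans (+-monoˡ-≤ 0 (∂₁≤1 (binom c 1))) (≤-trans (≤-reflexive (+-identityʳ 1)) (m≤m+n 1 (∂ 1 y)))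
  exchange₁ c zero (suc y) zero hx hy eq rewrite ∂₁-suc y | ∂-zero 1 = ≤-trans (+-monoˡ-≤ 0 (∂₁≤1 (binom c 1))) (≤-reflexive (+-identityʳ 1))
  exchange₁ c (suc x) (suc y) (suc g) hx hy eq rewrite ∂₁-suc x | ∂₁-suc y | ∂₁-suc g = +-monoˡ-≤ 1 (∂₁≤1 (binom c 1))
  exchange₁ c zero (suc y) (suc g) hx hy eq = ⊥-elim (<⇒≱ (≤-trans (m≤m+n (suc (binom c 1)) g) (≤-reflexive (trans (sym (+-suc (binom c 1) g)) (sym eq)))) hy)
  exchange₁ c (suc x) zero (suc g) hx hy eq = ⊥-elim (<⇒≱ (≤-trans (m≤m+n (suc (binom c 1)) g) (≤-reflexive (trans (sym (+-suc (binom c 1) g)) (trans (sym eq) (+-identityʳ (suc x)))))) hx)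
  peel₀ : Peel 0
  peel₀ zero β = m≤m⊔n (∂ 1 β) 0
  peel₀ (suc α) β = ≤-trans (∂₁≤1 (suc α + β)) (≤-trans (s≤s z≤n) (m≤n⊔m (∂ 1 β) (suc α)))

-- The induction step: the facts at level i imply those at level i+1.
-- Throughout, j = i+2 is the level whose subadditivity and exchange are
-- being proved, and blocks are split by Pascal's rule
-- C(c+1,j) = C(c,i+1) + C(c,j).
module LevelStep (i : ℕ) (L : LevelFacts i) where
  open LevelFacts L

  j : ℕ
  j = suc (suc i)

  ∂' ∂ⱼ : ℕ → ℕ
  ∂' = ∂ (suc i)
  ∂ⱼ = ∂ j

  -- The three binomials of Pascal's rule; C(c+1,j) = Z + Y, C(c+1,i+1) = W + Z.
  module Pascal (c : ℕ) where
    W Z Y : ℕ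
    W = binom c i
    Z = binom c (suc i)
    Y = binom c j

  -- ∂ (i+1) ≤ ∂ j, by induction on a universe C(a,j) and subadditivity at
  -- level i+1.
  levelMono-below : ∀ a x → x ≤ binom a j → ∂ (suc i) x ≤ ∂ j x
  levelMono-below zero x h rewrite n≤0⇒n≡0 h | ∂-zero (suc i) = z≤n
  levelMono-below (suc a) x h with ≤-or-above x (binom a j)
  ... | inj₁ p = levelMono-below a x p
  ... | inj₂ (r , refl) = begin
      ∂ (suc i) (binom a j + suc r) ≤⟨ subadd (binom a j) (suc r) ⟩
      ∂ (suc i) (binom a j) + ∂ (suc i) (suc r) ≤⟨ +-monoˡ-≤ _ (levelMono-below a (binom a j) ≤-refl) ⟩
      ∂ j (binom a j) + ∂ (suc i) (suc r) ≤⟨ +-monoˡ-≤ _ (∂-full-≤ (suc i) a) ⟩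
      binom a (suc i) + ∂ (suc i) (suc r) ≡⟨ sym (∂-block-suc (suc i) a r sr≤) ⟩
      ∂ j (binom a j + suc r) ∎
    where
    open ≤-Reasoning
    sr≤ : suc r ≤ binom a (suc i)
    sr≤ = +-cancelˡ-≤ (binom a j) _ _ (≤-trans h (≤-reflexive (+-comm (binom a (suc i)) (binom a j))))

  levelMono' : LevelMono (suc i)
  levelMono' x = levelMono-below (x + j) x (n≤binom x (suc i))

  -- The trading inequality used to prove exchange at level j: if
  -- u + s = C(c,j) then
  --   ∂ⱼ u + ∂' C(c,i+1) ≤ ∂ⱼ C(c,j) + ∂' (C(c,i+1) - s).
  Trade : ℕ → Set
  Trade c = ∀ s u → u + s ≡ binom c j → ∂ j u + ∂ (suc i) (binom c (suc i)) ≤ ∂ j (binom c j) + ∂ (suc i) (binom c (suc i) ∸ s)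

  module TradeStep (c : ℕ) (trade-c : Trade c) where
    open Pascal c

    Pascal-∂ⱼ : Z + ∂' Z ≤ ∂ⱼ (Z + Y)
    Pascal-∂ⱼ = ≤-trans (∂-block-full-≥ (suc i) c) (≤-reflexive (cong ∂ⱼ (+-comm Y Z)))

    -- s ≤ C(c,i+1): u = C(c,j) + v, use the block formula and the exchange
    -- inequality at level i+1
    trade-small : ∀ s u → u + s ≡ Z + Y → s ≤ Z → ∂ⱼ u + ∂' (W + Z) ≤ ∂ⱼ (Z + Y) + ∂' ((W + Z) ∸ s)
    trade-small s u eq s≤ with m≤n⇒∃[o]m+o≡n s≤
    ... | v , sv = begin
        ∂ⱼ u + ∂' (W + Z) ≤⟨ +-monoˡ-≤ _ ∂ⱼu≤ ⟩
        (Z + ∂' v) + ∂' (W + Z) ≡⟨ regroup₄ Z (∂' v) (∂' (W + Z)) ⟩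
        Z + (∂' (W + Z) + ∂' v) ≤⟨ +-monoʳ-≤ Z exchange-Z ⟩
        Z + (∂' Z + ∂' (W + v)) ≡⟨ sym (+-assoc Z _ _) ⟩
        (Z + ∂' Z) + ∂' (W + v) ≤⟨ +-monoˡ-≤ _ Pascal-∂ⱼ ⟩
        ∂ⱼ (Z + Y) + ∂' (W + v) ≡⟨ cong (λ t → ∂ⱼ (Z + Y) + ∂' t) (sym ZmS) ⟩
        ∂ⱼ (Z + Y) + ∂' ((W + Z) ∸ s) ∎
      where
      open ≤-Reasoning
      regroup₄ : ∀ a b c → (a + b) + c ≡ a + (c + b)
      regroup₄ = solve-∀
      v≤ : v ≤ Z
      v≤ = ≤-trans (m≤n+m v s) (≤-reflexive sv)
      u≡ : u ≡ Y + v
      u≡ = +-cancelʳ-≡ s u (Y + v) (trans eq (trans (cong (_+ Y) (sym sv)) (regroup₅ s v Y)))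
        where
        regroup₅ : ∀ s v Y → (s + v) + Y ≡ (Y + v) + s
        regroup₅ = solve-∀
      ∂ⱼu≤ : ∂ⱼ u ≤ Z + ∂' v
      ∂ⱼu≤ = subst (λ t → ∂ⱼ t ≤ Z + ∂' v) (sym u≡) (∂-block-≤ (suc i) c v v≤)
      exchange-Z : ∂' (W + Z) + ∂' v ≤ ∂' Z + ∂' (W + v)
      exchange-Z = exchange (suc c) Z (W + v) v (m≤n+m Z W) (+-monoʳ-≤ W v≤) (regroup₆ Z W v)
        where
        regroup₆ : ∀ Z W v → Z + (W + v) ≡ (W + Z) + v
        regroup₆ = solve-∀
      ZmS : (W + Z) ∸ s ≡ W + v
      ZmS = trans (cong (_∸ s) (trans (cong (W +_) (sym sv)) (regroup₇ W s v))) (m+n∸m≡n s (W + v))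
        where
        regroup₇ : ∀ W s v → W + (s + v) ≡ s + (W + v)
        regroup₇ = solve-∀

    -- s = C(c,i+1) + s' with 1 ≤ s' ≤ C(c,i): by unimodality s' ≤ C(c,i+1) too,
    -- and the inequality for c gives the first step of the chain
    trade-middle : ∀ s' u → u + s' ≡ Y → 1 ≤ s' → s' ≤ W → ∂ⱼ u + ∂' (W + Z) ≤ ∂ⱼ (Z + Y) + ∂' ((W + Z) ∸ (Z + s'))
    trade-middle s' u eq' 1≤s' s'≤W with m≤n⇒∃[o]m+o≡n (binom-unimodal c i s' s'≤W (≤-trans (m≤n+m s' u) (≤-reflexive eq'))) | m≤n⇒∃[o]m+o≡n s'≤W
    ... | t , st | w , sw = begin
        ∂ⱼ u + ∂' (W + Z) ≤⟨ +-≤-chain {∂ⱼ u} {∂' Z} {Z} {∂' t} {∂' (W + Z)} {∂' (Z + w)} i' ii ⟩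
        Z + ∂' (Z + w) ≤⟨ +-monoʳ-≤ Z iii ⟩
        Z + (W + ∂' w) ≡⟨ sym (+-assoc Z W _) ⟩
        (Z + W) + ∂' w ≤⟨ +-monoˡ-≤ _ iv ⟩
        ∂ⱼ (Z + Y) + ∂' w ≡⟨ cong (λ q → ∂ⱼ (Z + Y) + ∂' q) (sym remainder) ⟩
        ∂ⱼ (Z + Y) + ∂' ((W + Z) ∸ (Z + s')) ∎
      where
      open ≤-Reasoning
      s'≤Z : s' ≤ Z
      s'≤Z = ≤-trans (m≤m+n s' t) (≤-reflexive st)
      Z≥1 : 1 ≤ Z
      Z≥1 = ≤-trans 1≤s' s'≤Z
      w≤ : w ≤ W
      w≤ = ≤-trans (m≤n+m w s') (≤-reflexive sw)
      Zt : Z ∸ s' ≡ t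
      Zt = trans (cong (_∸ s') (sym st)) (m+n∸m≡n s' t)
      -- the inequality for c, with ∂' C(c,i+1) ≤ C(c,i+1)
      i' : ∂ⱼ u + ∂' Z ≤ Z + ∂' t
      i' = ≤-trans (trade-c s' u eq') (+-mono-≤ (∂-full-≤ (suc i) c) (≤-reflexive (cong ∂' Zt)))
      Zw : Z + w ≡ W + t
      Zw = trans (cong (_+ w) (sym st)) (trans (regroup₈ s' t w) (cong (_+ t) sw))
        where
        regroup₈ : ∀ s t w → (s + t) + w ≡ (s + w) + t
        regroup₈ = solve-∀
      -- exchange at level i+1 inside the block C(c+1,i+1) = C(c,i) + C(c,i+1)
      ii : ∂' (W + Z) + ∂' t ≤ ∂' Z + ∂' (Z + w)
      ii = exchange (suc c) Z (Z + w) t (m≤n+m Z W) (≤-trans (≤-reflexive Zw) (≤-trans (+-monoʳ-≤ W (≤-trans (m≤n+m t s') (≤-reflexive st))) ≤-refl))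
             (trans (cong (Z +_) Zw) (regroup₉ Z W t))
        where
        regroup₉ : ∀ Z W t → Z + (W + t) ≡ (W + Z) + t
        regroup₉ = solve-∀
      -- block formula at level i+1, then monotonicity in the level
      iii : ∂' (Z + w) ≤ W + ∂' w
      iii = ≤-trans (∂-block-≤ i c w w≤) (+-monoʳ-≤ W (levelMono w))
      -- C(c,i+1) + C(c,i) = C(c,i+1) + ∂' C(c,i+1) ≤ ∂ⱼ C(c+1,j)
      iv : Z + W ≤ ∂ⱼ (Z + Y)
      iv = ≤-trans (≤-reflexive (cong (Z +_) (sym (∂-full i c Z≥1)))) Pascal-∂ⱼ
      remainder : (W + Z) ∸ (Z + s') ≡ w
      remainder = trans (cong (_∸ (Z + s')) (trans (cong (_+ Z) (sym sw)) (regroup₁₀ s' w Z))) (m+n∸m≡n (Z + s') w)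
        where
        regroup₁₀ : ∀ s w Z → (s + w) + Z ≡ (Z + s) + w
        regroup₁₀ = solve-∀

    trade-suc : Trade (suc c)
    trade-suc s u eq with ≤-or-above s Z
    ... | inj₁ s≤ = trade-small s u eq s≤
    ... | inj₂ (s'' , refl) with suc s'' ≤? W
    ...   | yes p = trade-middle (suc s'') u eq' (s≤s z≤n) p
      where
      eq' : u + suc s'' ≡ Y
      eq' = +-cancelˡ-≡ Z _ _ (trans (regroup₁₁ Z u (suc s'')) eq)
        where
        regroup₁₁ : ∀ Z u s → Z + (u + s) ≡ u + (Z + s)
        regroup₁₁ = solve-∀
    ...   | no ¬p with m≤n⇒∃[o]m+o≡n (<⇒≤ (≰⇒> ¬p))
    ...     | k , ks = trade-large (binom-zero-or-pos c i)
      where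
      s' : ℕ
      s' = suc s''
      eq' : u + s' ≡ Y
      eq' = +-cancelˡ-≡ Z _ _ (trans (regroup₁₁ Z u s') eq)
        where
        regroup₁₁ : ∀ Z u s → Z + (u + s) ≡ u + (Z + s)
        regroup₁₁ = solve-∀
      Z0 : (W + Z) ∸ (Z + s') ≡ 0
      Z0 = m≤n⇒m∸n≡0 (≤-trans (≤-reflexive (+-comm W Z)) (+-monoʳ-≤ Z (<⇒≤ (≰⇒> ¬p))))
      -- s > C(c,i+1) + C(c,i): the right-hand side loses nothing more, so
      -- reduce to one of the previous cases
      trade-large : binom c i ≡ 0 ⊎ 1 ≤ binom c i → ∂ⱼ u + ∂' (W + Z) ≤ ∂ⱼ (Z + Y) + ∂' ((W + Z) ∸ (Z + s'))
      trade-large (inj₁ W0) = begin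
          ∂ⱼ u + ∂' (W + Z) ≤⟨ +-monoˡ-≤ _ (∂-mono j (≤-trans (m≤m+n u s') (≤-reflexive eq'))) ⟩
          ∂ⱼ Y + ∂' (W + Z) ≤⟨ trade-small Z Y (+-comm Y Z) ≤-refl ⟩
          ∂ⱼ (Z + Y) + ∂' ((W + Z) ∸ Z) ≡⟨ cong (λ q → ∂ⱼ (Z + Y) + ∂' q) (trans (m+n∸n≡m W Z) (trans W0 (sym Z0))) ⟩
          ∂ⱼ (Z + Y) + ∂' ((W + Z) ∸ (Z + s')) ∎
        where open ≤-Reasoning
      trade-large (inj₂ W≥1) = begin
          ∂ⱼ u + ∂' (W + Z) ≤⟨ +-monoˡ-≤ _ (∂-mono j (m≤m+n u k)) ⟩
          ∂ⱼ (u + k) + ∂' (W + Z) ≤⟨ trade-middle W (u + k) e W≥1 ≤-refl ⟩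
          ∂ⱼ (Z + Y) + ∂' ((W + Z) ∸ (Z + W)) ≡⟨ cong (λ q → ∂ⱼ (Z + Y) + ∂' q) (trans (m≤n⇒m∸n≡0 (≤-reflexive (+-comm W Z))) (sym Z0)) ⟩
          ∂ⱼ (Z + Y) + ∂' ((W + Z) ∸ (Z + s')) ∎
        where
        open ≤-Reasoning
        e : (u + k) + W ≡ Y
        e = trans (trans (+-assoc u k W) (cong (u +_) (trans (+-comm k W) ks))) eq'

  trade : ∀ c → Trade c
  trade zero s u eq with m+n≡0⇒m≡0×n≡0 {u} {s} eq
  ... | refl , refl = ≤-refl
  trade (suc c) = TradeStep.trade-suc c (trade c)

  -- Subadditivity and exchange at level j, restricted to a universe C(c,j);
  -- proved together by induction on c.
  SubaddBelow : ℕ → Set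
  SubaddBelow c = ∀ x y → x + y ≤ binom c j → ∂ j (x + y) ≤ ∂ j x + ∂ j y

  ExchangeAt : ℕ → Set
  ExchangeAt c = ∀ x y g → x ≤ binom c j → y ≤ binom c j → x + y ≡ binom c j + g → ∂ j (binom c j) + ∂ j g ≤ ∂ j x + ∂ j y

  module ExchangeStep (c : ℕ) (subadd-c : SubaddBelow c) (exchange-c : ExchangeAt c) where
    open Pascal c

    Pascal-∂ⱼ≡ : 1 ≤ Z → ∂ⱼ (Z + Y) ≡ Z + ∂' Z
    Pascal-∂ⱼ≡ h = trans (cong ∂ⱼ (+-comm Z Y)) (∂-block (suc i) c Z h ≤-refl)

    -- Subadditivity when x is above C(c,j): the block formula and
    -- subadditivity at level i+1.
    subadd-large : ∀ r y → (Y + suc r) + y ≤ Z + Y → ∂ⱼ ((Y + suc r) + y) ≤ ∂ⱼ (Y + suc r) + ∂ⱼ y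
    subadd-large r y h = begin
        ∂ⱼ ((Y + suc r) + y) ≡⟨ cong ∂ⱼ (+-assoc Y (suc r) y) ⟩
        ∂ⱼ (Y + suc (r + y)) ≡⟨ ∂-block-suc (suc i) c (r + y) excess≤ ⟩
        Z + ∂' (suc r + y) ≤⟨ +-monoʳ-≤ Z (subadd (suc r) y) ⟩
        Z + (∂' (suc r) + ∂' y) ≤⟨ +-monoʳ-≤ Z (+-monoʳ-≤ (∂' (suc r)) (levelMono' y)) ⟩
        Z + (∂' (suc r) + ∂ⱼ y) ≡⟨ sym (+-assoc Z _ _) ⟩
        (Z + ∂' (suc r)) + ∂ⱼ y ≡⟨ cong (_+ ∂ⱼ y) (sym (∂-block-suc (suc i) c r sr≤)) ⟩
        ∂ⱼ (Y + suc r) + ∂ⱼ y ∎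
      where
      open ≤-Reasoning
      excess≤ : suc (r + y) ≤ Z
      excess≤ = +-cancelˡ-≤ Y _ _ (≤-trans (≤-reflexive (sym (+-assoc Y (suc r) y))) (≤-trans h (≤-reflexive (+-comm Z Y))))
      sr≤ : suc r ≤ Z
      sr≤ = ≤-trans (m≤m+n (suc r) y) excess≤

    -- Subadditivity in the universe C(c+1,j).  If both parts are below C(c,j)
    -- but the sum is not, the exchange inequality for c applies.
    subadd-suc : SubaddBelow (suc c)
    subadd-suc x y h with ≤-or-above x Y | ≤-or-above y Y
    ... | inj₂ (r , refl) | _ = subadd-large r y h
    ... | inj₁ _ | inj₂ (r , refl) =
      subst₂ _≤_ (cong ∂ⱼ (+-comm (Y + suc r) x)) (+-comm (∂ⱼ (Y + suc r)) (∂ⱼ x))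
        (subadd-large r x (≤-trans (≤-reflexive (+-comm (Y + suc r) x)) h))
    ... | inj₁ x≤Y | inj₁ y≤Y with ≤-or-above (x + y) Y
    ...   | inj₁ q = subadd-c x y q
    ...   | inj₂ (r , e) = begin
        ∂ⱼ (x + y) ≡⟨ cong ∂ⱼ e ⟩
        ∂ⱼ (Y + suc r) ≡⟨ ∂-block-suc (suc i) c r sr≤ ⟩
        Z + ∂' (suc r) ≤⟨ +-mono-≤ (≤-reflexive (sym (∂-full (suc i) c Y≥1))) (levelMono' (suc r)) ⟩
        ∂ⱼ Y + ∂ⱼ (suc r) ≤⟨ exchange-c x y (suc r) x≤Y y≤Y e ⟩
        ∂ⱼ x + ∂ⱼ y ∎
      where
      open ≤-Reasoning
      sr≤ : suc r ≤ Z
      sr≤ = +-cancelˡ-≤ Y _ _ (≤-trans (≤-reflexive (sym e)) (≤-trans h (≤-reflexive (+-comm Z Y))))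
      Y≥1 : 1 ≤ Y
      Y≥1 = ≤-trans (s≤s z≤n) (+-cancelˡ-≤ Y _ _ (≤-trans (≤-reflexive (sym e)) (+-mono-≤ x≤Y y≤Y)))

    Pascal-∂ⱼ≡′ : ∀ p → suc p ≤ Z → ∂ⱼ (Z + Y) ≡ Z + ∂' Z
    Pascal-∂ⱼ≡′ p h = Pascal-∂ⱼ≡ (≤-trans (s≤s z≤n) h)

    upper-part : ∀ p → Y + suc p ≤ Z + Y → suc p ≤ Z
    upper-part p h = +-cancelˡ-≤ Y _ _ (≤-trans h (≤-reflexive (+-comm Z Y)))

    -- Exchange when both parts lie above C(c,j): depending on whether their
    -- excesses sum to at least C(c,i+1), use exchange at level i+1 or the
    -- trading inequality with subadditivity.
    exchange-both-large : ∀ p q g → Y + suc p ≤ Z + Y → Y + suc q ≤ Z + Y → (Y + suc p) + (Y + suc q) ≡ (Z + Y) + g → ∂ⱼ (Z + Y) + ∂ⱼ g ≤ ∂ⱼ (Y + suc p) + ∂ⱼ (Y + suc q)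
    exchange-both-large p q g hx hy eq = by-cases (Z ≤? (suc p + suc q))
      where
      sp≤ : suc p ≤ Z
      sp≤ = upper-part p hx
      sq≤ : suc q ≤ Z
      sq≤ = upper-part q hy
      h : ℕ
      h = suc p + suc q
      excess-sum : Y + h ≡ Z + g
      excess-sum = +-cancelˡ-≡ Y _ _ (trans (regroup₂ Y (suc p) (suc q)) (trans eq (regroup₃ Z Y g)))
        where
        regroup₂ : ∀ Y a b → Y + (Y + (a + b)) ≡ (Y + a) + (Y + b)
        regroup₂ = solve-∀
        regroup₃ : ∀ Z Y g → (Z + Y) + g ≡ Y + (Z + g)
        regroup₃ = solve-∀
      Goal : Set
      Goal = ∂ⱼ (Z + Y) + ∂ⱼ g ≤ ∂ⱼ (Y + suc p) + ∂ⱼ (Y + suc q)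
      excess≥Z : Σ ℕ (λ g' → Z + g' ≡ h) → Goal
      excess≥Z (g' , eg) = begin
        ∂ⱼ (Z + Y) + ∂ⱼ g ≡⟨ cong₂ _+_ (Pascal-∂ⱼ≡′ p sp≤) (cong ∂ⱼ g≡) ⟩
        (Z + ∂' Z) + ∂ⱼ (Y + g') ≤⟨ +-monoʳ-≤ _ (∂-block-≤ (suc i) c g' g'≤) ⟩
        (Z + ∂' Z) + (Z + ∂' g') ≡⟨ regroup₁ Z (∂' Z) (∂' g') ⟩
        (Z + Z) + (∂' Z + ∂' g') ≤⟨ +-monoʳ-≤ (Z + Z) (exchange c (suc p) (suc q) g' sp≤ sq≤ (sym eg)) ⟩
        (Z + Z) + (∂' (suc p) + ∂' (suc q)) ≡⟨ regroup₁′ Z (∂' (suc p)) (∂' (suc q)) ⟩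
        (Z + ∂' (suc p)) + (Z + ∂' (suc q)) ≡⟨ sym (cong₂ _+_ (∂-block-suc (suc i) c p sp≤) (∂-block-suc (suc i) c q sq≤)) ⟩
        ∂ⱼ (Y + suc p) + ∂ⱼ (Y + suc q) ∎
        where
        open ≤-Reasoning
        regroup₁ : ∀ a b c → (a + b) + (a + c) ≡ (a + a) + (b + c)
        regroup₁ = solve-∀
        regroup₁′ : ∀ a b c → (a + a) + (b + c) ≡ (a + b) + (a + c)
        regroup₁′ = solve-∀
        g≡ : g ≡ Y + g'
        g≡ = +-cancelˡ-≡ Z _ _ (trans (sym excess-sum) (trans (cong (Y +_) (sym eg)) (regroup₄ Y Z g')))
          where
          regroup₄ : ∀ Y Z g → Y + (Z + g) ≡ Z + (Y + g)
          regroup₄ = solve-∀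
        g'≤ : g' ≤ Z
        g'≤ = ≤-trans (+-cancelˡ-≤ Z g' (suc q) (≤-trans (≤-reflexive eg) (+-monoˡ-≤ (suc q) sp≤))) sq≤
      excess<Z : Σ ℕ (λ s → h + s ≡ Z) → Goal
      excess<Z (s , es) = begin
        ∂ⱼ (Z + Y) + ∂ⱼ g ≡⟨ cong (_+ ∂ⱼ g) (Pascal-∂ⱼ≡′ p sp≤) ⟩
        (Z + ∂' Z) + ∂ⱼ g ≡⟨ regroup₅ Z (∂' Z) (∂ⱼ g) ⟩
        Z + (∂ⱼ g + ∂' Z) ≤⟨ +-monoʳ-≤ Z trade-step ⟩
        Z + (Z + ∂' h) ≤⟨ +-monoʳ-≤ Z (+-monoʳ-≤ Z (subadd (suc p) (suc q))) ⟩
        Z + (Z + (∂' (suc p) + ∂' (suc q))) ≡⟨ regroup₆ Z (∂' (suc p)) (∂' (suc q)) ⟩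
        (Z + ∂' (suc p)) + (Z + ∂' (suc q)) ≡⟨ sym (cong₂ _+_ (∂-block-suc (suc i) c p sp≤) (∂-block-suc (suc i) c q sq≤)) ⟩
        ∂ⱼ (Y + suc p) + ∂ⱼ (Y + suc q) ∎
        where
        open ≤-Reasoning
        regroup₅ : ∀ a b c → (a + b) + c ≡ a + (c + b)
        regroup₅ = solve-∀
        regroup₆ : ∀ a b c → a + (a + (b + c)) ≡ (a + b) + (a + c)
        regroup₆ = solve-∀
        gs : g + s ≡ Y
        gs = +-cancelˡ-≡ h _ _ (trans (regroup₇ h g s) (trans (cong (_+ g) es) (sym (trans (+-comm h Y) excess-sum))))
          where
          regroup₇ : ∀ h g s → h + (g + s) ≡ (h + s) + g
          regroup₇ = solve-∀
        trade-step : ∂ⱼ g + ∂' Z ≤ Z + ∂' h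
        trade-step = ≤-trans (trade c s g gs) (+-mono-≤ (∂-full-≤ (suc i) c) (≤-reflexive (cong ∂' (trans (cong (_∸ s) (sym es)) (m+n∸n≡m h s)))))
      by-cases : Dec (Z ≤ h) → Goal
      by-cases (yes le) = excess≥Z (m≤n⇒∃[o]m+o≡n le)
      by-cases (no nle) = excess<Z (m≤n⇒∃[o]m+o≡n (<⇒≤ (≰⇒> nle)))

    -- Exchange when x is below and y above C(c,j): the exchange inequality
    -- for c combined with the trading inequality.
    exchange-mixed : ∀ x q g → x ≤ Y → Y + suc q ≤ Z + Y → x + (Y + suc q) ≡ (Z + Y) + g → ∂ⱼ (Z + Y) + ∂ⱼ g ≤ ∂ⱼ x + ∂ⱼ (Y + suc q)
    exchange-mixed x q g x≤Y hy eq = decompose (m≤n⇒∃[o]m+o≡n sq≤)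
      where
      sq≤ : suc q ≤ Z
      sq≤ = upper-part q hy
      Goal : Set
      Goal = ∂ⱼ (Z + Y) + ∂ⱼ g ≤ ∂ⱼ x + ∂ⱼ (Y + suc q)
      excess-sum : x + suc q ≡ Z + g
      excess-sum = +-cancelˡ-≡ Y _ _ (trans (regroup₂ Y x (suc q)) (trans eq (regroup₃ Z Y g)))
        where
        regroup₂ : ∀ Y a b → Y + (a + b) ≡ a + (Y + b)
        regroup₂ = solve-∀
        regroup₃ : ∀ Z Y g → (Z + Y) + g ≡ Y + (Z + g)
        regroup₃ = solve-∀
      -- with Z = (q+1) + t, x = t + g and Y = t + v: combine exchange for c with trading
      chain : ∀ t → suc q + t ≡ Z → x ≡ t + g → Σ ℕ (λ v → t + v ≡ Y) → Goal
      chain t et xe (v , ev) = begin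
        ∂ⱼ (Z + Y) + ∂ⱼ g ≡⟨ cong (_+ ∂ⱼ g) (Pascal-∂ⱼ≡′ q sq≤) ⟩
        (Z + ∂' Z) + ∂ⱼ g ≡⟨ regroup₅ Z (∂' Z) (∂ⱼ g) ⟩
        Z + (∂ⱼ g + ∂' Z) ≤⟨ +-monoʳ-≤ Z combined ⟩
        Z + (∂ⱼ x + ∂' (suc q)) ≡⟨ regroup₉ Z (∂ⱼ x) (∂' (suc q)) ⟩
        ∂ⱼ x + (Z + ∂' (suc q)) ≡⟨ cong (∂ⱼ x +_) (sym (∂-block-suc (suc i) c q sq≤)) ⟩
        ∂ⱼ x + ∂ⱼ (Y + suc q) ∎
        where
        open ≤-Reasoning
        regroup₅ : ∀ a b c → (a + b) + c ≡ a + (c + b)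
        regroup₅ = solve-∀
        regroup₉ : ∀ a b c → a + (b + c) ≡ b + (a + c)
        regroup₉ = solve-∀
        exchange-step : ∂ⱼ g + ∂ⱼ Y ≤ ∂ⱼ x + ∂ⱼ v
        exchange-step = ≤-trans (≤-reflexive (+-comm (∂ⱼ g) (∂ⱼ Y)))
               (exchange-c x v g x≤Y (≤-trans (m≤n+m v t) (≤-reflexive ev))
                 (trans (cong (_+ v) xe) (trans (regroup₁₀ t g v) (cong (_+ g) ev))))
          where
          regroup₁₀ : ∀ t g v → (t + g) + v ≡ (t + v) + g
          regroup₁₀ = solve-∀
        trade-step : ∂' Z + ∂ⱼ v ≤ ∂ⱼ Y + ∂' (suc q)
        trade-step = ≤-trans (≤-reflexive (+-comm (∂' Z) (∂ⱼ v)))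
               (≤-trans (trade c t v (trans (+-comm v t) ev))
                 (≤-reflexive (cong (λ z → ∂ⱼ Y + ∂' z) (trans (cong (_∸ t) (sym et)) (m+n∸n≡m (suc q) t)))))
        combined : ∂ⱼ g + ∂' Z ≤ ∂ⱼ x + ∂' (suc q)
        combined = +-≤-chain {∂ⱼ g} {∂ⱼ Y} {∂ⱼ x} {∂ⱼ v} {∂' Z} {∂' (suc q)} exchange-step trade-step
      decompose : Σ ℕ (λ t → suc q + t ≡ Z) → Goal
      decompose (t , et) = chain t et xe (m≤n⇒∃[o]m+o≡n (≤-trans t≤x x≤Y))
        where
        xe : x ≡ t + g
        xe = +-cancelʳ-≡ (suc q) x (t + g) (trans excess-sum (trans (cong (_+ g) (sym et)) (regroup₈ (suc q) t g)))
          where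
          regroup₈ : ∀ a t g → (a + t) + g ≡ (t + g) + a
          regroup₈ = solve-∀
        t≤x : t ≤ x
        t≤x = ≤-trans (m≤m+n t g) (≤-reflexive (sym xe))

    -- Exchange when both parts are below C(c,j): twice the exchange inequality
    -- for c and once the trading inequality.
    exchange-both-small : ∀ x y g → x ≤ Y → y ≤ Y → x + y ≡ (Z + Y) + g → ∂ⱼ (Z + Y) + ∂ⱼ g ≤ ∂ⱼ x + ∂ⱼ y
    exchange-both-small x y g x≤Y y≤Y eq = by-Z (binom-zero-or-pos c (suc i))
      where
      sum≡ : x + y ≡ Y + (Z + g)
      sum≡ = trans eq (regroup₃ Z Y g)
        where
        regroup₃ : ∀ Z Y g → (Z + Y) + g ≡ Y + (Z + g)
        regroup₃ = solve-∀
      exchange-step : ∂ⱼ Y + ∂ⱼ (Z + g) ≤ ∂ⱼ x + ∂ⱼ y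
      exchange-step = exchange-c x y (Z + g) x≤Y y≤Y sum≡
      Z+g≤Y : Z + g ≤ Y
      Z+g≤Y = +-cancelˡ-≤ Y _ _ (≤-trans (≤-reflexive (sym sum≡)) (+-mono-≤ x≤Y y≤Y))
      by-Z : Z ≡ 0 ⊎ 1 ≤ Z → ∂ⱼ (Z + Y) + ∂ⱼ g ≤ ∂ⱼ x + ∂ⱼ y
      by-Z (inj₁ Z0) = ≤-trans (≤-reflexive (cong₂ _+_ (cong (λ z → ∂ⱼ (z + Y)) Z0) (cong (λ z → ∂ⱼ (z + g)) (sym Z0)))) exchange-step
      by-Z (inj₂ Z≥1) = with-Y-split (m≤n⇒∃[o]m+o≡n (≤-trans (m≤m+n Z g) Z+g≤Y))
       where
       with-Y-split : Σ ℕ (λ v' → Z + v' ≡ Y) → ∂ⱼ (Z + Y) + ∂ⱼ g ≤ ∂ⱼ x + ∂ⱼ y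
       with-Y-split (v' , ev') = begin
          ∂ⱼ (Z + Y) + ∂ⱼ g ≡⟨ cong (_+ ∂ⱼ g) (Pascal-∂ⱼ≡ Z≥1) ⟩
          (Z + ∂' Z) + ∂ⱼ g ≡⟨ regroup₅ Z (∂' Z) (∂ⱼ g) ⟩
          Z + (∂ⱼ g + ∂' Z) ≤⟨ +-monoʳ-≤ Z combined ⟩
          Z + (∂ⱼ (Z + g) + ∂' (Z ∸ Z)) ≡⟨ cong (λ z → Z + (∂ⱼ (Z + g) + ∂' z)) (n∸n≡0 Z) ⟩
          Z + (∂ⱼ (Z + g) + ∂' 0) ≡⟨ cong (λ z → Z + (∂ⱼ (Z + g) + z)) (∂-zero (suc i)) ⟩
          Z + (∂ⱼ (Z + g) + 0) ≡⟨ cong (Z +_) (+-identityʳ _) ⟩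
          Z + ∂ⱼ (Z + g) ≡⟨ cong (_+ ∂ⱼ (Z + g)) (sym (∂-full (suc i) c Y≥1)) ⟩
          ∂ⱼ Y + ∂ⱼ (Z + g) ≤⟨ exchange-step ⟩
          ∂ⱼ x + ∂ⱼ y ∎
        where
        open ≤-Reasoning
        regroup₅ : ∀ a b c → (a + b) + c ≡ a + (c + b)
        regroup₅ = solve-∀
        Y≥1 : 1 ≤ Y
        Y≥1 = ≤-trans Z≥1 (≤-trans (m≤m+n Z g) Z+g≤Y)
        exchange-step′ : ∂ⱼ g + ∂ⱼ Y ≤ ∂ⱼ (Z + g) + ∂ⱼ v'
        exchange-step′ = ≤-trans (≤-reflexive (+-comm (∂ⱼ g) (∂ⱼ Y)))
               (exchange-c (Z + g) v' g Z+g≤Y (≤-trans (m≤n+m v' Z) (≤-reflexive ev'))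
                 (trans (regroup₁₁ Z g v') (cong (_+ g) ev')))
          where
          regroup₁₁ : ∀ Z g v → (Z + g) + v ≡ (Z + v) + g
          regroup₁₁ = solve-∀
        trade-step′ : ∂' Z + ∂ⱼ v' ≤ ∂ⱼ Y + ∂' (Z ∸ Z)
        trade-step′ = ≤-trans (≤-reflexive (+-comm (∂' Z) (∂ⱼ v'))) (trade c Z v' (trans (+-comm v' Z) ev'))
        combined : ∂ⱼ g + ∂' Z ≤ ∂ⱼ (Z + g) + ∂' (Z ∸ Z)
        combined = +-≤-chain {∂ⱼ g} {∂ⱼ Y} {∂ⱼ (Z + g)} {∂ⱼ v'} {∂' Z} {∂' (Z ∸ Z)} exchange-step′ trade-step′

    exchange-suc : ExchangeAt (suc c)
    exchange-suc x y g hx hy eq with ≤-or-above x Y | ≤-or-above y Y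
    ... | inj₂ (p , refl) | inj₂ (q , refl) = exchange-both-large p q g hx hy eq
    ... | inj₁ x≤Y | inj₂ (q , refl) = exchange-mixed x q g x≤Y hy eq
    ... | inj₂ (p , refl) | inj₁ y≤Y =
      subst (λ z → ∂ⱼ (Z + Y) + ∂ⱼ g ≤ z) (+-comm (∂ⱼ y) (∂ⱼ (Y + suc p)))
        (exchange-mixed y p g y≤Y hx (trans (+-comm y (Y + suc p)) eq))
    ... | inj₁ x≤Y | inj₁ y≤Y = exchange-both-small x y g x≤Y y≤Y eq

  subadd-exchange-below : ∀ c → SubaddBelow c × ExchangeAt c
  subadd-exchange-below zero = subadd-zero , exchange-zero
    where
    subadd-zero : SubaddBelow zero
    subadd-zero x y h with m+n≡0⇒m≡0×n≡0 {x} {y} (n≤0⇒n≡0 h)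
    ... | refl , refl rewrite ∂-zero j = z≤n
    exchange-zero : ExchangeAt zero
    exchange-zero x y g hx hy eq rewrite n≤0⇒n≡0 hx | n≤0⇒n≡0 hy | sym eq = ≤-refl
  subadd-exchange-below (suc c) = ExchangeStep.subadd-suc c subadd-c exchange-c , ExchangeStep.exchange-suc c subadd-c exchange-c
    where
    subadd-c : SubaddBelow c
    subadd-c = proj₁ (subadd-exchange-below c)
    exchange-c : ExchangeAt c
    exchange-c = proj₂ (subadd-exchange-below c)

  subadd' : Subadditive j
  subadd' x y = proj₁ (subadd-exchange-below ((x + y) + suc (suc i))) x y (n≤binom (x + y) (suc i))

  exchange' : Exchange j
  exchange' c = proj₂ (subadd-exchange-below c)

  -- The peeling inequality at level i+1 inside a universe C(a,·), by
  -- induction on a and the position of α, β relative to C(a,i+1), C(a,j).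
  peel-below : ∀ a α β → α ≤ binom a (suc i) → β ≤ binom a j → ∂ j (α + β) ≤ ∂ (suc i) α + (∂ j β ⊔ α)
  peel-below zero α β ha hb rewrite n≤0⇒n≡0 ha | n≤0⇒n≡0 hb | ∂-zero j = z≤n
  peel-below (suc a) α β ha hb with ≤-or-above α (binom a (suc i)) | ≤-or-above β (binom a j)
  ... | inj₁ pa | inj₁ pb = peel-below a α β pa pb
  ... | inj₁ pa | inj₂ (q , refl) = sub (≤-or-above (α + suc q) Z)
    where
    open Pascal a
    sq≤ : suc q ≤ Z
    sq≤ = +-cancelˡ-≤ Y _ _ (≤-trans hb (≤-reflexive (+-comm Z Y)))
    Djβ : ∂ⱼ (Y + suc q) ≡ Z + ∂' (suc q)
    Djβ = ∂-block-suc (suc i) a q sq≤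
    Goal : Set
    Goal = ∂ⱼ (α + (Y + suc q)) ≤ ∂' α + (∂ⱼ (Y + suc q) ⊔ α)
    sub : α + suc q ≤ Z ⊎ Σ ℕ (λ g → α + suc q ≡ Z + suc g) → Goal
    sub (inj₁ le) = begin
        ∂ⱼ (α + (Y + suc q)) ≡⟨ cong ∂ⱼ (regroup₁ α Y (suc q)) ⟩
        ∂ⱼ (Y + (α + suc q)) ≤⟨ ∂-block-≤ (suc i) a (α + suc q) le ⟩
        Z + ∂' (α + suc q) ≤⟨ +-monoʳ-≤ Z (subadd α (suc q)) ⟩
        Z + (∂' α + ∂' (suc q)) ≡⟨ regroup₂ Z (∂' α) (∂' (suc q)) ⟩
        ∂' α + (Z + ∂' (suc q)) ≡⟨ cong (∂' α +_) (sym Djβ) ⟩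
        ∂' α + ∂ⱼ (Y + suc q) ≤⟨ +-monoʳ-≤ (∂' α) (m≤m⊔n _ α) ⟩
        ∂' α + (∂ⱼ (Y + suc q) ⊔ α) ∎
      where
      open ≤-Reasoning
      regroup₁ : ∀ a Y s → a + (Y + s) ≡ Y + (a + s)
      regroup₁ = solve-∀
      regroup₂ : ∀ Z a b → Z + (a + b) ≡ a + (Z + b)
      regroup₂ = solve-∀
    sub (inj₂ (g , e)) = begin
        ∂ⱼ (α + (Y + suc q)) ≡⟨ cong ∂ⱼ e2 ⟩
        ∂ⱼ ((Z + Y) + suc g) ≡⟨ ∂-block-suc (suc i) (suc a) g hg ⟩
        (W + Z) + ∂' (suc g) ≡⟨ cong (λ w → (w + Z) + ∂' (suc g)) (sym (∂-full i a Z≥1)) ⟩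
        (∂' Z + Z) + ∂' (suc g) ≡⟨ regroup₃ (∂' Z) Z (∂' (suc g)) ⟩
        Z + (∂' Z + ∂' (suc g)) ≤⟨ +-monoʳ-≤ Z (exchange a α (suc q) (suc g) pa sq≤ e) ⟩
        Z + (∂' α + ∂' (suc q)) ≡⟨ regroup₂ Z (∂' α) (∂' (suc q)) ⟩
        ∂' α + (Z + ∂' (suc q)) ≡⟨ cong (∂' α +_) (sym Djβ) ⟩
        ∂' α + ∂ⱼ (Y + suc q) ≤⟨ +-monoʳ-≤ (∂' α) (m≤m⊔n _ α) ⟩
        ∂' α + (∂ⱼ (Y + suc q) ⊔ α) ∎
      where
      open ≤-Reasoning
      regroup₂ : ∀ Z a b → Z + (a + b) ≡ a + (Z + b)
      regroup₂ = solve-∀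
      regroup₃ : ∀ a Z b → (a + Z) + b ≡ Z + (a + b)
      regroup₃ = solve-∀
      Z≥1 : 1 ≤ Z
      Z≥1 = ≤-trans (s≤s z≤n) sq≤
      e2 : α + (Y + suc q) ≡ (Z + Y) + suc g
      e2 = trans (regroup₄ α Y (suc q)) (trans (cong (Y +_) e) (regroup₅ Y Z (suc g)))
        where
        regroup₄ : ∀ a Y s → a + (Y + s) ≡ Y + (a + s)
        regroup₄ = solve-∀
        regroup₅ : ∀ Y Z g → Y + (Z + g) ≡ (Z + Y) + g
        regroup₅ = solve-∀
      hg : suc g ≤ W + Z
      hg = ≤-trans (+-cancelˡ-≤ Z (suc g) α (≤-trans (≤-reflexive (sym e)) (≤-trans (+-monoʳ-≤ α sq≤) (≤-reflexive (+-comm α Z))))) (≤-trans pa (m≤n+m Z W))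
  -- α in the upper part: monotonicity, block formula, peeling one level down
  ... | inj₂ (p , refl) | inj₁ pb = begin
        ∂ⱼ ((Z + suc p) + β) ≤⟨ ∂-mono j h1 ⟩
        ∂ⱼ ((Z + Y) + suc p) ≡⟨ ∂-block-suc (suc i) (suc a) p sp≤' ⟩
        (W + Z) + ∂' (suc p) ≤⟨ +-monoʳ-≤ (W + Z) LS ⟩
        (W + Z) + (∂ i (suc p) + suc p) ≡⟨ regroup₁ W Z (∂ i (suc p)) (suc p) ⟩
        (W + ∂ i (suc p)) + (Z + suc p) ≡⟨ cong (_+ (Z + suc p)) (sym (∂-block-suc i a p sp≤)) ⟩
        ∂' (Z + suc p) + (Z + suc p) ≤⟨ +-monoʳ-≤ (∂' (Z + suc p)) (m≤n⊔m (∂ⱼ β) (Z + suc p)) ⟩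
        ∂' (Z + suc p) + (∂ⱼ β ⊔ (Z + suc p)) ∎
    where
    open ≤-Reasoning
    open Pascal a
    regroup₁ : ∀ W Z a b → (W + Z) + (a + b) ≡ (W + a) + (Z + b)
    regroup₁ = solve-∀
    sp≤ : suc p ≤ W
    sp≤ = +-cancelˡ-≤ Z _ _ (≤-trans ha (≤-reflexive (+-comm W Z)))
    sp≤' : suc p ≤ W + Z
    sp≤' = ≤-trans sp≤ (m≤m+n W Z)
    h1 : (Z + suc p) + β ≤ (Z + Y) + suc p
    h1 = ≤-trans (+-monoʳ-≤ (Z + suc p) pb) (≤-reflexive (regroup₆ Z (suc p) Y))
      where
      regroup₆ : ∀ Z p Y → (Z + p) + Y ≡ (Z + Y) + p
      regroup₆ = solve-∀
    LS : ∂' (suc p) ≤ ∂ i (suc p) + suc p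
    LS = ≤-trans (≤-reflexive (cong ∂' (sym (+-identityʳ (suc p)))))
           (≤-trans (peel (suc p) 0) (≤-reflexive (cong (λ z → ∂ i (suc p) + (z ⊔ suc p)) (∂-zero (suc i)))))
  -- both in the upper parts: block formulas and peeling one level down
  ... | inj₂ (p , refl) | inj₂ (q , refl) = begin
        ∂ⱼ ((Z + suc p) + (Y + suc q)) ≡⟨ cong ∂ⱼ (regroup₁ Z (suc p) Y (suc q)) ⟩
        ∂ⱼ ((Z + Y) + suc (p + suc q)) ≡⟨ ∂-block-suc (suc i) (suc a) (p + suc q) h ⟩
        (W + Z) + ∂' (suc p + suc q) ≤⟨ +-monoʳ-≤ (W + Z) (peel (suc p) (suc q)) ⟩
        (W + Z) + (∂ i (suc p) + (∂' (suc q) ⊔ suc p)) ≡⟨ regroup₂ W Z (∂ i (suc p)) (∂' (suc q) ⊔ suc p) ⟩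
        (W + ∂ i (suc p)) + (Z + (∂' (suc q) ⊔ suc p)) ≡⟨ cong₂ _+_ (sym (∂-block-suc i a p sp≤)) (+-distribˡ-⊔ Z (∂' (suc q)) (suc p)) ⟩
        ∂' (Z + suc p) + ((Z + ∂' (suc q)) ⊔ (Z + suc p)) ≡⟨ cong (λ z → ∂' (Z + suc p) + (z ⊔ (Z + suc p))) (sym (∂-block-suc (suc i) a q sq≤)) ⟩
        ∂' (Z + suc p) + (∂ⱼ (Y + suc q) ⊔ (Z + suc p)) ∎
    where
    open ≤-Reasoning
    open Pascal a
    regroup₁ : ∀ Z p Y q → (Z + p) + (Y + q) ≡ (Z + Y) + (p + q)
    regroup₁ = solve-∀
    regroup₂ : ∀ W Z a b → (W + Z) + (a + b) ≡ (W + a) + (Z + b)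
    regroup₂ = solve-∀
    sp≤ : suc p ≤ W
    sp≤ = +-cancelˡ-≤ Z _ _ (≤-trans ha (≤-reflexive (+-comm W Z)))
    sq≤ : suc q ≤ Z
    sq≤ = +-cancelˡ-≤ Y _ _ (≤-trans hb (≤-reflexive (+-comm Z Y)))
    h : suc p + suc q ≤ W + Z
    h = +-mono-≤ sp≤ sq≤

  peel' : Peel (suc i)
  peel' α β = peel-below ((α + β) + j) α β ha hb
    where
    ha : α ≤ binom ((α + β) + j) (suc i)
    ha = ≤-trans (n≤binom α i) (binom-monoˡ (suc i) (≤-trans (+-monoʳ-≤ α (n≤1+n (suc i))) (+-monoˡ-≤ j (m≤m+n α β))))
    hb : β ≤ binom ((α + β) + j) j
    hb = ≤-trans (n≤binom β (suc i)) (binom-monoˡ j (+-monoˡ-≤ j (m≤n+m β α)))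

  levelFacts-suc : LevelFacts (suc i)
  levelFacts-suc = record { subadd = subadd' ; exchange = exchange' ; levelMono = levelMono' ; peel = peel' }

levelFacts : ∀ i → LevelFacts i
levelFacts zero = levelFacts-base
levelFacts (suc i) = LevelStep.levelFacts-suc i (levelFacts i)

incBound-split : ∀ d α β → incBound (suc d) (α + β) ≤ incBound d α + (incBound (suc d) β ⊔ (α + β))
incBound-split d α β = begin
    (α + β) + ∂ (suc d) (α + β) ≤⟨ +-monoʳ-≤ (α + β) (LevelFacts.peel (levelFacts d) α β) ⟩
    (α + β) + (∂ d α + (∂ (suc d) β ⊔ α)) ≡⟨ regroup α β (∂ d α) (∂ (suc d) β ⊔ α) ⟩
    (α + ∂ d α) + (β + (∂ (suc d) β ⊔ α)) ≡⟨ cong ((α + ∂ d α) +_) (+-distribˡ-⊔ β (∂ (suc d) β) α) ⟩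
    (α + ∂ d α) + ((β + ∂ (suc d) β) ⊔ (β + α)) ≡⟨ cong (λ z → (α + ∂ d α) + ((β + ∂ (suc d) β) ⊔ z)) (+-comm β α) ⟩
    (α + ∂ d α) + ((β + ∂ (suc d) β) ⊔ (α + β)) ∎
  where
  open ≤-Reasoning
  regroup : ∀ a b c m → (a + b) + (c + m) ≡ (a + c) + (b + m)
  regroup = solve-∀

remove : ∀ {A : Set} {x : A} (L : List A) → x ∈ L → Σ (List A) λ L' → (length L ≡ suc (length L')) × (∀ y → y ∈ L → y ≢ x → y ∈ L')
remove (z ∷ L) (here refl) = L , refl , λ { y (here refl) ne → ⊥-elim (ne refl) ; y (there p) ne → p }
remove (z ∷ L) (there p) with remove L p
... | L' , e , h = z ∷ L' , cong suc e , λ { y (here refl) ne → here refl ; y (there q) ne → there (h y q ne) }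

unique-⊆⇒length≤ : ∀ {A : Set} (K L : List A) → Unique K → (∀ x → x ∈ K → x ∈ L) → length K ≤ length L
unique-⊆⇒length≤ [] L _ _ = z≤n
unique-⊆⇒length≤ (x ∷ K) L (x∉ ∷ uK) sub with remove L (sub x (here refl))
... | L' , e , h = ≤-trans (s≤s (unique-⊆⇒length≤ K L' uK (λ y y∈ → h y (sub y (there y∈)) (λ eq → All.lookup x∉ y∈ (sym eq))))) (≤-reflexive (sym e))

length-filter-partition : ∀ {A : Set} {P : A → Set} (P? : Decidable P) xs → length (filter P? xs) + length (filter (¬? ∘ P?) xs) ≡ length xs
length-filter-partition P? [] = refl
length-filter-partition P? (x ∷ xs) with P? x
... | yes p = cong suc (length-filter-partition P? xs)
... | no ¬p = trans (+-suc _ _) (cong suc (length-filter-partition P? xs))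

vec-η : ∀ {A : Set} {n} (x : Vec A (suc n)) → x ≡ head x ∷ tail x
vec-η (a ∷ w) = refl

unique-map-tail : ∀ {d} b (xs : List (Vec ℕ (suc d))) → Unique xs → (∀ v → v ∈ xs → head v ≡ b) → Unique (map tail xs)
unique-map-tail b [] _ _ = []
unique-map-tail b (x ∷ xs) (x∉ ∷ u) hb = All.tabulate (λ {z} z∈ → nt z z∈) ∷ unique-map-tail b xs u (λ v v∈ → hb v (there v∈))
  where
  nt : ∀ z → z ∈ map tail xs → tail x ≢ z
  nt z z∈ eq with ∈-map⁻ tail z∈
  ... | y , y∈ , refl = All.lookup x∉ y∈ (trans (vec-η x) (trans (cong₂ _∷_ (trans (hb x (here refl)) (sym (hb y (there y∈)))) eq) (sym (vec-η y))))

∈⇒length≥1 : ∀ {A : Set} {x : A} {L} → x ∈ L → 1 ≤ length L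
∈⇒length≥1 (here _) = s≤s z≤n
∈⇒length≥1 (there _) = s≤s z≤n

-- The shifts of u = (u₁,…,u_d): for each position k, keep u₁,…,u_{k-1} and
-- add 1 to u_k,…,u_d (k = 1 gives shiftUp u; k = d+1 gives u itself).  For
-- a d-subset each shift is π(u) for some π ∈ Inc₁ (shift-is-σ).
shiftUp : ∀ {d} → Vec ℕ d → Vec ℕ d
shiftUp = vmap suc

shifts : ∀ {d} → Vec ℕ d → List (Vec ℕ d)
shifts [] = [] ∷ []
shifts (b ∷ w) = (suc b ∷ shiftUp w) ∷ map (b ∷_) (shifts w)

ShiftsIn : ∀ {d} → List (Vec ℕ d) → List (Vec ℕ d) → Set
ShiftsIn F L = ∀ u → u ∈ F → ∀ v → v ∈ shifts u → v ∈ L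

shiftUp-injective : ∀ {d} {x y : Vec ℕ d} → shiftUp x ≡ shiftUp y → x ≡ y
shiftUp-injective {x = []} {[]} _ = refl
shiftUp-injective {x = a ∷ x} {b ∷ y} eq = cong₂ _∷_ (suc-injective (cong head eq)) (shiftUp-injective (cong tail eq))

shifts-head≥ : ∀ {d} (u v : Vec ℕ (suc d)) → v ∈ shifts u → head u ≤ head v
shifts-head≥ (c ∷ w) v (here refl) = n≤1+n c
shifts-head≥ (c ∷ w) v (there p) with ∈-map⁻ (c ∷_) p
... | z , _ , refl = ≤-refl

shiftUp∈shifts : ∀ {d} (u : Vec ℕ (suc d)) → shiftUp u ∈ shifts u
shiftUp∈shifts (c ∷ w) = here refl

head-shiftUp : ∀ {d} (u : Vec ℕ (suc d)) → head (shiftUp u) ≡ suc (head u)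
head-shiftUp (c ∷ w) = refl

ShiftsBound : ℕ → Set
ShiftsBound d = (F L : List (Vec ℕ d)) → Unique F → Unique L → ShiftsIn F L →
  incBound d (length F) ≤ length L

length-Vec0≤1 : ∀ (F : List (Vec ℕ 0)) → Unique F → length F ≤ 1
length-Vec0≤1 [] _ = z≤n
length-Vec0≤1 (x ∷ []) _ = ≤-refl
length-Vec0≤1 ([] ∷ [] ∷ F) ((ne ∷ _) ∷ _) = ⊥-elim (ne refl)

module SplitAtHead {d : ℕ} (b : ℕ) where
  startsWith? : Decidable (λ (v : Vec ℕ (suc d)) → head v ≡ b)
  startsWith? v = head v ≟ b

  lower upper : List (Vec ℕ (suc d)) → List (Vec ℕ (suc d))
  lower = filter startsWith?
  upper = filter (¬? ∘ startsWith?)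

  lower+upper : ∀ F → length (lower F) + length (upper F) ≡ length F
  lower+upper = length-filter-partition startsWith?

  lower-shifts : ∀ F L → ShiftsIn F L → ShiftsIn (map tail (lower F)) (map tail (lower L))
  lower-shifts F L cl w w∈ v v∈ with ∈-map⁻ tail w∈
  ... | x , x∈lower , refl = ∈-map⁺ tail (∈-filter⁺ startsWith? {xs = L} (cl x x∈F (b ∷ v) bv∈shifts) refl)
    where
    x∈F : x ∈ F
    x∈F = proj₁ (∈-filter⁻ startsWith? {xs = F} x∈lower)
    x≡ : x ≡ b ∷ tail x
    x≡ = trans (vec-η x) (cong (_∷ tail x) (proj₂ (∈-filter⁻ startsWith? {xs = F} x∈lower)))
    bv∈shifts : b ∷ v ∈ shifts x
    bv∈shifts = subst (λ y → b ∷ v ∈ shifts y) (sym x≡) (there (∈-map⁺ (b ∷_) v∈))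

  lower-bound : ShiftsBound d → ∀ F L → Unique F → Unique L → ShiftsIn F L →
    incBound d (length (lower F)) ≤ length (lower L)
  lower-bound bound F L uF uL cl =
    subst₂ _≤_ (cong (incBound d) (length-map tail (lower F))) (length-map tail (lower L))
      (bound (map tail (lower F)) (map tail (lower L))
        (unique-map-tail b (lower F) (Unique.filter⁺ startsWith? uF) (λ v v∈ → proj₂ (∈-filter⁻ startsWith? {xs = F} v∈)))
        (unique-map-tail b (lower L) (Unique.filter⁺ startsWith? uL) (λ v v∈ → proj₂ (∈-filter⁻ startsWith? {xs = L} v∈)))
        (lower-shifts F L cl))

  module AboveMinimum (F L : List (Vec ℕ (suc d))) (b≤ : ∀ v → v ∈ F → b ≤ head v) (cl : ShiftsIn F L) where
    upper-shifts : ShiftsIn (upper F) (upper L)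
    upper-shifts u u∈ v v∈ = ∈-filter⁺ (¬? ∘ startsWith?) {xs = L} (cl u u∈F v v∈) head≢b
      where
      u∈F : u ∈ F
      u∈F = proj₁ (∈-filter⁻ (¬? ∘ startsWith?) {xs = F} u∈)
      b<head : b < head u
      b<head = ≤∧≢⇒< (b≤ u u∈F) (λ e → proj₂ (∈-filter⁻ (¬? ∘ startsWith?) {xs = F} u∈) (sym e))
      head≢b : ¬ (head v ≡ b)
      head≢b e = <⇒≢ (<-≤-trans b<head (shifts-head≥ u v v∈)) (sym e)

    shiftUp-in-upper : ∀ x → x ∈ map shiftUp F → x ∈ upper L
    shiftUp-in-upper x x∈ with ∈-map⁻ shiftUp x∈
    ... | u , u∈F , refl = ∈-filter⁺ (¬? ∘ startsWith?) {xs = L} (cl u u∈F (shiftUp u) (shiftUp∈shifts u))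
            (λ e → <⇒≢ (s≤s (b≤ u u∈F)) (sym (trans (sym (head-shiftUp u)) e)))

    -- shiftUp is injective, so the upper part of L has at least |F| members.
    length≤upper : Unique F → length F ≤ length (upper L)
    length≤upper uF = subst (_≤ length (upper L)) (length-map shiftUp F)
      (unique-⊆⇒length≤ (map shiftUp F) (upper L) (Unique.map⁺ shiftUp-injective uF) shiftUp-in-upper)

-- Let b
-- be the least first coordinate in F.  The part of L starting with b is
-- bounded by induction on d; the rest of L contains the shifts of the members
-- of F not starting with b (induction on |F|) and also shiftUp F.  Conclude
-- by incBound-split.
shifts-bound : ∀ d → ShiftsBound d
shifts-bound zero [] L uF uL cl = z≤n
shifts-bound zero ([] ∷ F) L uF uL cl =
  ≤-trans (≤-reflexive (+-identityʳ _)) (≤-trans (length-Vec0≤1 ([] ∷ F) uF) (∈⇒length≥1 (cl [] (here refl) [] (here refl))))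
shifts-bound (suc d) F L = by-size (length F) F L ≤-refl
  where
  by-size : ∀ n (F L : List (Vec ℕ (suc d))) → length F ≤ n → Unique F → Unique L → ShiftsIn F L →
    incBound (suc d) (length F) ≤ length L
  by-size n [] L _ _ _ _ rewrite ∂-zero (suc d) = z≤n
  by-size zero (u ∷ F') L () _ _ _
  by-size (suc n) F@(u ∷ F') L |F|≤ uF uL cl = begin
      incBound (suc d) (length F)                   ≡⟨ cong (incBound (suc d)) (sym (lower+upper F)) ⟩
      incBound (suc d) (α + β)                      ≤⟨ incBound-split d α β ⟩
      incBound d α + (incBound (suc d) β ⊔ (α + β)) ≤⟨ +-mono-≤ (lower-bound (shifts-bound d) F L uF uL cl) (⊔-lub upper≤ shiftUp≤) ⟩
      length (lower L) + length (upper L)           ≡⟨ lower+upper L ⟩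
      length L                                      ∎
    where
    open ≤-Reasoning
    m : Vec ℕ (suc d)
    m = argmin head u F'
    m∈F : m ∈ F
    m∈F with argmin-sel head u F'
    ... | inj₁ m≡u = subst (_∈ F) (sym m≡u) (here refl)
    ... | inj₂ m∈F' = there m∈F'
    b : ℕ
    b = head m
    b≤ : ∀ v → v ∈ F → b ≤ head v
    b≤ v (here refl) = f[argmin]≤f[⊤] {f = head} u F'
    b≤ v (there v∈) = All.lookup (f[argmin]≤f[xs] {f = head} u F') v∈
    open SplitAtHead b
    open AboveMinimum F L b≤ cl
    α β : ℕ
    α = length (lower F)
    β = length (upper F)
    β≤n : β ≤ n
    β≤n = ≤-pred (≤-trans (+-monoˡ-≤ β (∈⇒length≥1 (∈-filter⁺ startsWith? {xs = F} m∈F refl)))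
                   (≤-trans (≤-reflexive (lower+upper F)) |F|≤))
    upper≤ : incBound (suc d) β ≤ length (upper L)
    upper≤ = by-size n (upper F) (upper L) β≤n (Unique.filter⁺ (¬? ∘ startsWith?) uF)
               (Unique.filter⁺ (¬? ∘ startsWith?) uL) upper-shifts
    shiftUp≤ : α + β ≤ length (upper L)
    shiftUp≤ = subst (_≤ length (upper L)) (sym (lower+upper F)) (length≤upper uF)

σ : ℕ → ℕ → ℕ
σ k j with j <? k
... | yes _ = j
... | no _ = suc j

σ-lt : ∀ {k j} → j < k → σ k j ≡ j
σ-lt {k} {j} h with j <? k
... | yes _ = refl
... | no ¬h = ⊥-elim (¬h h)

σ-ge : ∀ {k j} → k ≤ j → σ k j ≡ suc j
σ-ge {k} {j} h with j <? k
... | yes p = ⊥-elim (<⇒≱ p h)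
... | no _ = refl

σ-self : ∀ k j → j ≤ σ k j
σ-self k j with j <? k
... | yes _ = ≤-refl
... | no _ = n≤1+n j

σ-isInc₁ : ∀ k → IsInc₁ (σ k)
σ-isInc₁ k j j≥1 = by-cases (j <? k)
  where
  by-cases : Dec (j < k) → (1 ≤ σ k j) × (σ k j < σ k (suc j)) × (σ k j ≤ suc j)
  by-cases (yes p) rewrite σ-lt p = j≥1 , σ-self k (suc j) , n≤1+n j
  by-cases (no ¬p) rewrite σ-ge (≮⇒≥ ¬p) | σ-ge {k} {suc j} (≤-trans (≮⇒≥ ¬p) (n≤1+n j)) = s≤s z≤n , ≤-refl , ≤-refl

Increasing : ∀ {d} → ℕ → Vec ℕ d → Set
Increasing lo [] = ⊤
Increasing lo (b ∷ w) = lo < b × Increasing b w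

σ-above : ∀ {d} c (w : Vec ℕ d) → Increasing c w → ∀ k → k ≤ c → vmap (σ k) w ≡ shiftUp w
σ-above c [] _ k _ = refl
σ-above c (x ∷ w) (c<x , sw) k k≤c = cong₂ _∷_ (σ-ge (≤-trans k≤c (<⇒≤ c<x))) (σ-above x w sw k (≤-trans k≤c (<⇒≤ c<x)))

shift-is-σ : ∀ {d} lo (u : Vec ℕ d) → Increasing lo u → ∀ v → v ∈ shifts u → Σ ℕ (λ k → lo < k × v ≡ vmap (σ k) u)
shift-is-σ lo [] _ v (here refl) = suc lo , n<1+n lo , refl
shift-is-σ lo (b ∷ w) (lo<b , sw) v (here refl) = b , lo<b , cong₂ _∷_ (sym (σ-ge ≤-refl)) (sym (σ-above b w sw b ≤-refl))
shift-is-σ lo (b ∷ w) (lo<b , sw) v (there p) with ∈-map⁻ (b ∷_) p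
... | v' , v'∈ , refl with shift-is-σ b w sw v' v'∈
... | k , b<k , e = k , <-trans lo<b b<k , cong₂ _∷_ (sym (σ-lt b<k)) e

dSubset⇒increasing : ∀ {d} lo (u : Vec ℕ d) → (∀ i → lo < lookup u i) → (∀ (i j : Fin d) → i Fin.< j → lookup u i < lookup u j) → Increasing lo u
dSubset⇒increasing lo [] _ _ = tt
dSubset⇒increasing lo (b ∷ w) h1 h2 = h1 Fin.zero , dSubset⇒increasing b w (λ i → h2 Fin.zero (Fin.suc i) (s≤s z≤n)) (λ i j i<j → h2 (Fin.suc i) (Fin.suc j) (s≤s i<j))

shift∈Inc : ∀ {d} {F : List (Vec ℕ d)} → All IsDSubset F → ∀ u → u ∈ F → ∀ v → v ∈ shifts u → InInc F v
shift∈Inc dsub u u∈ v v∈ with All.lookup dsub u∈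
... | pos , incr with shift-is-σ 0 u (dSubset⇒increasing 0 u pos incr) v v∈
... | k , _ , v≡σu = u , u∈ , σ k , σ-isInc₁ k , v≡σu

IncD≤incBound : ∀ {d m n} → IncD d m n → n ≤ incBound d m
IncD≤incBound incD-zero = z≤n
IncD≤incBound (incD-rep as rep) = incSum≤incBound rep

corollary3p13 : (d : ℕ) → 1 ≤ d →
    (F : List (Vec ℕ d)) → Unique F → All IsDSubset F →
    (L : List (Vec ℕ d)) → Unique L →
    (∀ v → v ∈ L → InInc F v) → (∀ v → InInc F v → v ∈ L) →
    (n : ℕ) → IncD d (length F) n →
    n ≤ length L
corollary3p13 d _ F uF dsub L uL _ Inc⊆L n incD =
  ≤-trans (IncD≤incBound incD) (shifts-bound d F L uF uL shifts⊆L)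
  where
  shifts⊆L : ShiftsIn F L
  shifts⊆L u u∈ v v∈ = Inc⊆L v (shift∈Inc dsub u u∈ v v∈)
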